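{- Let $G$ be a connected graph with a fixed vertex $v_0$, and for $m \ge 0$ let $G(m)$ be the graph defined below. Then: (i) for every integer $i \ge 0$, $\mathcal{D}_w(G(m), i) = \emptyset$ if and only if $i > |V(G(m))|$ or $i < \gamma_w(G(m))$; (iii) for every $m \in \mathbb{N}$ ($m\ge 1$), $\gamma_w(G(m-1)) \le \gamma_w(G(m)) \le \gamma_w(G(m-1)) + 1$.
   Context: All graphs are finite and simple. For a connected graph $H$, a non-empty set $S \subseteq V(H)$ is a weakly connected dominating set of $H$ if the spanning subgraph of $H$ obtained by removing all edges joining two vertices of $V(H)\setminus S$ is connected. $\mathcal{D}_w(H,i)$ is the family of weakly connected dominating sets of $H$ of cardinality $i$, and $\gamma_w(H)$ is the minimum cardinality of a weakly connected dominating set of $H$. For $m\ge 0$, let $P_{m+1}$ be a path with vertices $y_0,y_1,\dots,y_m$ (edges $y_{k-1}y_k$); $G(m)$ is the graph obtained from $G$ and $P_{m+1}$ by identifying the vertex $v_0$ of $G$ with the end vertex $y_0$ of the path (so $G(0)=G$). -}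

module Defs where

open import Data.Nat using (ℕ; zero; suc)
open import Data.Bool using (Bool; true; false; _∨_)
open import Data.Fin using (Fin; zero; suc; _≟_)
open import Data.Fin.Subset using (Subset; _∈_; Nonempty; ∣_∣)
open import Data.Product using (_×_; ∃)
open import Data.Sum using (_⊎_)
open import Relation.Binary.PropositionalEquality using (_≡_; refl)
open import Relation.Nullary.Decidable using (⌊_⌋)
open import Relation.Binary.Construct.Closure.ReflexiveTransitive using (Star)

record Graph : Set where
  field
    order  : ℕ
    adj    : Fin order → Fin order → Bool
    adj-sym     : ∀ u v → adj u v ≡ adj v u
    adj-irrefl  : ∀ u → adj u u ≡ false
open Graph public

Vertex : Graph → Set
Vertex H = Fin (order H)

∣V∣ : Graph → ℕ
∣V∣ H = order H

ConnectedRel : {n : ℕ} → (Fin n → Fin n → Set) → Set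
ConnectedRel {n} R = (u v : Fin n) → Star R u v

Edge : (H : Graph) → Vertex H → Vertex H → Set
Edge H u v = adj H u v ≡ true

Connected : Graph → Set
Connected H = ConnectedRel (Edge H)

-- Edges of the spanning subgraph of H obtained by removing all edges joining
-- two vertices outside S: an edge uv survives iff u ∈ S or v ∈ S.
WeakEdge : (H : Graph) → Subset (order H) → Vertex H → Vertex H → Set
WeakEdge H S u v = Edge H u v × (u ∈ S ⊎ v ∈ S)

IsWCDS : (H : Graph) → Subset (order H) → Set
IsWCDS H S = Nonempty S × ConnectedRel (WeakEdge H S)

𝒟w : (H : Graph) → ℕ → Subset (order H) → Set
𝒟w H i S = IsWCDS H S × ∣ S ∣ ≡ i

IsγW : Graph → ℕ → Set
IsγW H γ = ∃ (λ S → 𝒟w H γ S) × (∀ S → IsWCDS H S → γ Data.Nat.≤ ∣ S ∣)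

-- Attach a new pendant vertex (index zero) to vertex v of H;
-- old vertex u becomes suc u.
private
  isV : {n : ℕ} → Fin n → Fin n → Bool
  isV v u = ⌊ u ≟ v ⌋

  padj : (H : Graph) → Vertex H → Fin (suc (order H)) → Fin (suc (order H)) → Bool
  padj H v zero zero = false
  padj H v zero (suc u) = isV v u
  padj H v (suc u) zero = isV v u
  padj H v (suc u) (suc w) = adj H u w

  padj-sym : (H : Graph) (v : Vertex H) → ∀ a b → padj H v a b ≡ padj H v b a
  padj-sym H v zero zero = refl
  padj-sym H v zero (suc u) = refl
  padj-sym H v (suc u) zero = refl
  padj-sym H v (suc u) (suc w) = adj-sym H u w

  padj-irr : (H : Graph) (v : Vertex H) → ∀ a → padj H v a a ≡ false
  padj-irr H v zero = refl
  padj-irr H v (suc u) = adj-irrefl H u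

pendant : (H : Graph) → Vertex H → Graph
pendant H v = record
  { order = suc (order H) ; adj = padj H v
  ; adj-sym = padj-sym H v ; adj-irrefl = padj-irr H v }

-- G(m) together with the end vertex y_m of the attached path.
-- G(0) = G with y_0 = v₀; G(m+1) = G(m) plus a new vertex y_{m+1} adjacent to y_m.
mutual
  ext : (G : Graph) → Vertex G → ℕ → Graph
  ext G v₀ zero = G
  ext G v₀ (suc m) = pendant (ext G v₀ m) (endV G v₀ m)

  endV : (G : Graph) (v₀ : Vertex G) (m : ℕ) → Vertex (ext G v₀ m)
  endV G v₀ zero = v₀
  endV G v₀ (suc m) = zero

module Submission where

-- Part (i) holds for every graph H with γ_w(H) = γ.  If some weakly
-- connected dominating set (WCDS) has size i then γ ≤ i ≤ |V(H)|.  Conversely,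
-- every superset of a WCDS is again a WCDS (surviving edges only multiply), and
-- a minimum WCDS can be padded with further vertices to any size between γ and
-- |V(H)|; so 𝒟w(H, i) is empty exactly when i lies outside that range.
--
-- Part (iii) is a statement about attaching one pendant vertex y′ to a vertex
-- y of a graph H, since G(m) arises from G(m-1) in exactly this way.
--   * Lower bound: from a WCDS S′ of H + y′ we obtain a WCDS of H of size at
--     most |S′|: drop y′, adding y instead when y′ ∈ S′.  Collapsing y′ onto y
--     turns every surviving walk of H + y′ into a surviving walk of H.
--   * Upper bound: if S is a WCDS of H then S ∪ {y′} is a WCDS of H + y′,
--     since the new edge y′y survives and so do all old surviving edges.

open import Defs
open import Data.Nat using (ℕ; _<_; _≤_; _∸_; _+_)
open import Data.Product using (_×_; ∃)
open import Data.Sum using (_⊎_)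
open import Relation.Nullary using (¬_)
open import Function.Bundles using (_⇔_)

open import Data.Nat using (zero; suc; s≤s)
open import Data.Nat.Properties
  using (≤-trans; ≤-refl; ≤-pred; _≤?_; ≰⇒>; <⇒≱; +-suc; +-identityʳ; +-comm; m+[n∸m]≡n)
open import Data.Bool using (Bool)
open import Data.Fin using (Fin; zero; suc; _≟_)
open import Data.Fin.Subset using (Subset; inside; outside; _∈_; _⊆_; ∣_∣)
open import Data.Fin.Subset.Properties using (∣p∣≤n; ∣p∣≤∣x∷p∣)
open import Data.Vec using ([]; _∷_; _[_]≔_)
open import Data.Vec.Base using (here; there)
open import Data.Product using (_,_)
open import Data.Sum using (inj₁; inj₂)
open import Data.Empty using (⊥-elim)
open import Relation.Nullary using (yes; no)
open import Relation.Binary.PropositionalEquality using (_≡_; refl; sym; trans; cong; subst)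
open import Relation.Binary.Construct.Closure.ReflexiveTransitive
  using (Star; ε; _◅_; _◅◅_; map; gmap; kleisliStar)
open import Function.Bundles using (mk⇔)

-- Enlarging S only adds surviving edges, so supersets of a WCDS are WCDSs.
wcds-⊆ : (H : Graph) {S T : Subset (order H)} → S ⊆ T → IsWCDS H S → IsWCDS H T
wcds-⊆ H {S} {T} S⊆T ((x , x∈S) , connected) =
  (x , S⊆T x∈S) , λ u v → map enlarge (connected u v)
  where
  enlarge : ∀ {a b} → WeakEdge H S a b → WeakEdge H T a b
  enlarge (e , inj₁ a∈S) = e , inj₁ (S⊆T a∈S)
  enlarge (e , inj₂ b∈S) = e , inj₂ (S⊆T b∈S)

pad : ∀ {n} (S : Subset n) (k : ℕ) → ∣ S ∣ + k ≤ n →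
      ∃ λ T → S ⊆ T × ∣ T ∣ ≡ ∣ S ∣ + k
pad [] zero _ = [] , (λ x∈ → x∈) , refl
pad (inside ∷ S) k (s≤s fits) with pad S k fits
... | T , S⊆T , size = inside ∷ T , extend , cong suc size
  where
  extend : inside ∷ S ⊆ inside ∷ T
  extend here = here
  extend (there x∈S) = there (S⊆T x∈S)
pad (outside ∷ S) zero _ = outside ∷ S , (λ x∈ → x∈) , sym (+-identityʳ ∣ S ∣)
pad {suc n} (outside ∷ S) (suc k) fits
  with pad S k (≤-pred (subst (_≤ suc n) (+-suc ∣ S ∣ k) fits))
... | T , S⊆T , size = inside ∷ T , extend , trans (cong suc size) (sym (+-suc ∣ S ∣ k))
  where
  extend : outside ∷ S ⊆ inside ∷ T
  extend (there x∈S) = there (S⊆T x∈S)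

𝒟w-empty⇔ : (H : Graph) (i γ : ℕ) → IsγW H γ →
            (¬ ∃ (λ S → 𝒟w H i S)) ⇔ (∣V∣ H < i ⊎ i < γ)
𝒟w-empty⇔ H i γ ((S₀ , S₀-wcds , ∣S₀∣≡γ) , minimal) = mk⇔ outside-range no-set
  where
  no-set : ∣V∣ H < i ⊎ i < γ → ¬ ∃ (λ S → 𝒟w H i S)
  no-set (inj₁ V<i) (S , _ , ∣S∣≡i) = <⇒≱ V<i (subst (_≤ ∣V∣ H) ∣S∣≡i (∣p∣≤n S))
  no-set (inj₂ i<γ) (S , S-wcds , ∣S∣≡i) = <⇒≱ i<γ (subst (γ ≤_) ∣S∣≡i (minimal S S-wcds))

  padded : γ ≤ i → i ≤ ∣V∣ H → ∃ (λ S → 𝒟w H i S)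
  padded γ≤i i≤V with pad S₀ (i ∸ γ) fits
    where
    fits : ∣ S₀ ∣ + (i ∸ γ) ≤ ∣V∣ H
    fits = subst (λ s → s + (i ∸ γ) ≤ ∣V∣ H) (sym ∣S₀∣≡γ)
                 (subst (_≤ ∣V∣ H) (sym (m+[n∸m]≡n γ≤i)) i≤V)
  ... | T , S₀⊆T , ∣T∣≡ =
    T , wcds-⊆ H S₀⊆T S₀-wcds , trans ∣T∣≡ (trans (cong (_+ (i ∸ γ)) ∣S₀∣≡γ) (m+[n∸m]≡n γ≤i))

  outside-range : ¬ ∃ (λ S → 𝒟w H i S) → ∣V∣ H < i ⊎ i < γ
  outside-range empty with i ≤? ∣V∣ H | γ ≤? i
  ... | no  i≰V | _       = inj₁ (≰⇒> i≰V)
  ... | yes _   | no  γ≰i = inj₂ (≰⇒> γ≰i)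
  ... | yes i≤V | yes γ≤i = ⊥-elim (empty (padded γ≤i i≤V))

-- insert S z = S ∪ {z}; adding a vertex to a set raises its size by at most
-- one, which bounds the set produced when the pendant vertex is traded for y.
insert : ∀ {n} → Subset n → Fin n → Subset n
insert S z = S [ z ]≔ inside

insert-∈ : ∀ {n} (S : Subset n) (z : Fin n) → z ∈ insert S z
insert-∈ (_ ∷ S) zero = here
insert-∈ (_ ∷ S) (suc z) = there (insert-∈ S z)

insert-⊇ : ∀ {n} (S : Subset n) (z : Fin n) → S ⊆ insert S z
insert-⊇ (_ ∷ S) zero here = here
insert-⊇ (_ ∷ S) zero (there x∈S) = there x∈S
insert-⊇ (_ ∷ S) (suc z) here = here
insert-⊇ (_ ∷ S) (suc z) (there x∈S) = there (insert-⊇ S z x∈S)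

insert-size : ∀ {n} (S : Subset n) (z : Fin n) → ∣ insert S z ∣ ≤ suc ∣ S ∣
insert-size (b ∷ S) zero = s≤s (∣p∣≤∣x∷p∣ b S)
insert-size (outside ∷ S) (suc z) = insert-size S z
insert-size (inside ∷ S) (suc z) = s≤s (insert-size S z)

module Pendant (H : Graph) (y : Vertex H) where

  H′ : Graph
  H′ = pendant H y

  pendant-neighbour : ∀ u → Edge H′ zero (suc u) → y ≡ u
  pendant-neighbour u e with u ≟ y
  pendant-neighbour u refl | yes u≡y = sym u≡y

  pendant-edge : Edge H′ zero (suc y)
  pendant-edge with y ≟ y
  ... | yes _   = refl
  ... | no  y≢y = ⊥-elim (y≢y refl)

  collapse : Vertex H′ → Vertex H
  collapse zero = y
  collapse (suc u) = u

  -- A surviving edge of H′ for b ∷ S collapses to a walk of length ≤ 1 that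
  -- survives in H for any T ⊇ S: edges at y′ collapse to the point y.
  collapse-edge : (b : Bool) (S T : Subset (order H)) → S ⊆ T →
                  ∀ {a c} → WeakEdge H′ (b ∷ S) a c →
                  Star (WeakEdge H T) (collapse a) (collapse c)
  collapse-edge b S T S⊆T {zero} {zero} (() , _)
  collapse-edge b S T S⊆T {zero} {suc u} (e , _)
    rewrite pendant-neighbour u e = ε
  collapse-edge b S T S⊆T {suc u} {zero} (e , _)
    rewrite pendant-neighbour u (trans (adj-sym H′ zero (suc u)) e) = ε
  collapse-edge b S T S⊆T {suc u} {suc w} (e , inj₁ (there u∈S)) = (e , inj₁ (S⊆T u∈S)) ◅ ε
  collapse-edge b S T S⊆T {suc u} {suc w} (e , inj₂ (there w∈S)) = (e , inj₂ (S⊆T w∈S)) ◅ ε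

  collapse-connected : (b : Bool) (S T : Subset (order H)) → S ⊆ T →
                       ConnectedRel (WeakEdge H′ (b ∷ S)) → ConnectedRel (WeakEdge H T)
  collapse-connected b S T S⊆T connected u v =
    kleisliStar collapse (collapse-edge b S T S⊆T) (connected (suc u) (suc v))

  shrink : (S′ : Subset (order H′)) → IsWCDS H′ S′ → ∃ λ T → IsWCDS H T × ∣ T ∣ ≤ ∣ S′ ∣
  shrink (outside ∷ S) ((zero , ()) , _)
  shrink (outside ∷ S) ((suc x , there x∈S) , connected) =
    S , ((x , x∈S) , collapse-connected outside S S (λ u∈ → u∈) connected) , ≤-refl
  shrink (inside ∷ S) (_ , connected) =
    insert S y
    , ((y , insert-∈ S y) , collapse-connected inside S (insert S y) (insert-⊇ S y) connected)
    , insert-size S y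

  grow : (S : Subset (order H)) → IsWCDS H S → IsWCDS H′ (inside ∷ S)
  grow S (_ , connected) = (zero , here) , connected′
    where
    lift : ∀ {a b} → WeakEdge H S a b → WeakEdge H′ (inside ∷ S) (suc a) (suc b)
    lift (e , inj₁ a∈S) = e , inj₁ (there a∈S)
    lift (e , inj₂ b∈S) = e , inj₂ (there b∈S)

    old-walk : ∀ a b → Star (WeakEdge H′ (inside ∷ S)) (suc a) (suc b)
    old-walk a b = gmap suc lift (connected a b)

    connected′ : ConnectedRel (WeakEdge H′ (inside ∷ S))
    connected′ zero zero = ε
    connected′ zero (suc b) = (pendant-edge , inj₁ here) ◅ old-walk y b
    connected′ (suc a) zero =
      old-walk a y ◅◅ (trans (adj-sym H′ (suc y) zero) pendant-edge , inj₂ here) ◅ ε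
    connected′ (suc a) (suc b) = old-walk a b

  γw-bounds : (γ γ′ : ℕ) → IsγW H γ → IsγW H′ γ′ → γ ≤ γ′ × γ′ ≤ γ + 1
  γw-bounds γ γ′ ((S , S-wcds , ∣S∣≡γ) , minimal) ((S′ , S′-wcds , ∣S′∣≡γ′) , minimal′)
    with shrink S′ S′-wcds
  ... | T , T-wcds , ∣T∣≤∣S′∣ =
    ≤-trans (minimal T T-wcds) (subst (∣ T ∣ ≤_) ∣S′∣≡γ′ ∣T∣≤∣S′∣)
    , subst (γ′ ≤_) (trans (cong suc ∣S∣≡γ) (+-comm 1 γ)) (minimal′ (inside ∷ S) (grow S S-wcds))

lemma3p1 : (G : Graph) (v₀ : Vertex G) → Connected G → (m : ℕ) →
    ((i γ : ℕ) → IsγW (ext G v₀ m) γ →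
      ((¬ ∃ (λ S → 𝒟w (ext G v₀ m) i S)) ⇔ (∣V∣ (ext G v₀ m) < i ⊎ i < γ)))
    × (1 ≤ m → (γ γ′ : ℕ) → IsγW (ext G v₀ (m ∸ 1)) γ → IsγW (ext G v₀ m) γ′ →
        γ ≤ γ′ × γ′ ≤ γ + 1)
lemma3p1 G v₀ _ m = (λ i γ → 𝒟w-empty⇔ (ext G v₀ m) i γ) , consecutive m
  where
  -- G(k+1) is G(k) with a pendant vertex attached at y_k.
  consecutive : (m : ℕ) → 1 ≤ m → (γ γ′ : ℕ) → IsγW (ext G v₀ (m ∸ 1)) γ →
                IsγW (ext G v₀ m) γ′ → γ ≤ γ′ × γ′ ≤ γ + 1
  consecutive (suc k) _ = Pendant.γw-bounds (ext G v₀ k) (endV G v₀ k)
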